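{- There are infinitely many positive integers $m$ for which the inequalities $$\sigma(2m+5)>\sigma(6m+17)\quad\text{and}\quad \sigma(5m+4)>\sigma(6m+7)$$ hold simultaneously.
   Context: $\sigma(n)=\sum_{d\mid n} d$ denotes the sum of the positive divisors of the positive integer $n$. -}

module Defs where

open import Data.Nat using (ℕ; suc)
open import Data.Nat.Divisibility using (_∣?_)
open import Data.List using (filter; upTo; map)
open import Data.Nat.ListAction using (sum)

-- σ n = sum of positive divisors d of n, i.e. d ∈ {1,…,n} with d ∣ n.
-- (σ 0 = 0 by this convention; only positive arguments are used.)
σ : ℕ → ℕ
σ n = sum (filter (λ d → d ∣? n) (map suc (upTo n)))

{-# OPTIONS --safe #-}
-- Let K be the odd part of lcm(1, …, 255) and let m run through a class r modulo
-- 128 K = lcm(1, …, 255) chosen so that K ∣ 2m + 5 and 16 ∣ 5m + 4.  The divisors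
-- (2m + 5)/d, d odd below 256, give σ(2m + 5) ≥ 3.4 (2m + 5), and 1, 2, 4, 8, 16 times
-- (5m + 4)/16 give σ(5m + 4) ≥ (31/16)(5m + 4); so either inequality can only fail when
-- the aliquot sum σ(n) − n is large for n = 6m + 17 resp. n = 6m + 7.  These n run through
-- progressions α + β x with gcd(α, β) = 1 and every d < 256 dividing β, so no d ∈ (1, 256)
-- divides n, and each d ≥ 256 divides at most L/d + 1 of L consecutive terms.  Writing
-- σ(n) − n = Σ_{d ∣ n, d > 1} n/d and grouping d into dyadic blocks, the aliquot sums over
-- x ∈ [L, 2L) average at most about n/32, so by Markov's inequality each inequality fails
-- for fewer than L/2 of these x, and some x satisfies both.
module Submission where

open import Defs
open import Data.Nat using (ℕ; _+_; _*_; _<_; _>_)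
open import Data.Product using (∃-syntax; _×_)
open import Data.Bool.Base using (true; false; if_then_else_)
open import Data.List.Base using (List; []; _∷_; map; filter; upTo; applyUpTo; foldr)
open import Data.List.Properties using (map-upTo; map-∘)
open import Data.List.Relation.Unary.All using (All; []; _∷_; all?)
import Data.List.Relation.Unary.All as All
import Data.List.Relation.Unary.All.Properties as All
open import Data.List.Relation.Unary.Unique.Propositional using (Unique; []; _∷_)
import Data.List.Relation.Unary.Unique.Propositional.Properties as Unique
open import Data.Nat.Base
open import Data.Nat.Coprimality using (Coprime; coprime?; coprime-divisor)
open import Data.Nat.Divisibility
  using (_∣_; _∣?_; divides; 1∣_; 0∣⇒≡0; ∣⇒≤; ∣-trans; ∣m+n∣m⇒∣n; ∣m⇒∣m*n; *-monoʳ-∣)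
open import Data.Nat.DivMod
  using (_/_; _%_; n/1≡n; m*n/n≡m; m/n*n≤m; m/n/o≡m/[n*o]; m≡m%n+[m/n]*n; m%n<n; /-monoʳ-≤; /-monoˡ-≤; /-congʳ)
open import Data.Nat.LCM using (lcm)
open import Data.Nat.ListAction using (sum)
open import Data.Nat.Properties
open import Data.Nat.Tactic.RingSolver using (solve-∀)
open import Data.Product.Base using (_,_)
open import Function.Base using (_∘_)
open import Level using (Level)
open import Relation.Binary.PropositionalEquality
open import Relation.Nullary.Decidable using (Dec; yes; no; does; dec-true; dec-false; from-yes; _→-dec_)
open import Relation.Nullary.Negation.Core using (¬_; contradiction)
open import Relation.Unary using (Pred; Decidable)

open import Algebra.Properties.CommutativeSemigroup +-commutativeSemigroup using (interchange)
open import Data.List.Relation.Unary.Unique.DecPropositional _≟_ using (unique?)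

private
  variable
    ℓ : Level
    a n : ℕ
    f g : ℕ → ℕ
    P Q : Pred ℕ ℓ

sumFrom : ℕ → ℕ → (ℕ → ℕ) → ℕ
sumFrom a zero    f = 0
sumFrom a (suc n) f = f a + sumFrom (suc a) n f

private
  head∈range : a < a + suc n
  head∈range {a} = m<m+n a z<s

  tail∈range : ∀ {i} → i < suc a + n → i < a + suc n
  tail∈range {a} {n} {i} = subst (i <_) (sym (+-suc a n))

sumFrom-cong : (∀ i → a ≤ i → i < a + n → f i ≡ g i) → sumFrom a n f ≡ sumFrom a n g
sumFrom-cong {n = zero}  f≡g = refl
sumFrom-cong {a} {n = suc n} f≡g =
  cong₂ _+_ (f≡g a ≤-refl head∈range)
            (sumFrom-cong λ i a<i i<n → f≡g i (<⇒≤ a<i) (tail∈range i<n))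

sumFrom-mono-≤ : (∀ i → a ≤ i → i < a + n → f i ≤ g i) → sumFrom a n f ≤ sumFrom a n g
sumFrom-mono-≤ {n = zero}  f≤g = z≤n
sumFrom-mono-≤ {a} {n = suc n} f≤g =
  +-mono-≤ (f≤g a ≤-refl head∈range)
           (sumFrom-mono-≤ λ i a<i i<n → f≤g i (<⇒≤ a<i) (tail∈range i<n))

sumFrom-const : ∀ a n c → sumFrom a n (λ _ → c) ≡ n * c
sumFrom-const a zero    c = refl
sumFrom-const a (suc n) c = cong (c +_) (sumFrom-const (suc a) n c)

sumFrom-≡0 : (∀ i → a ≤ i → i < a + n → f i ≡ 0) → sumFrom a n f ≡ 0
sumFrom-≡0 {a} {n} p = trans (sumFrom-cong p) (trans (sumFrom-const a n 0) (*-zeroʳ n))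

sumFrom-+ : ∀ a m n f → sumFrom a (m + n) f ≡ sumFrom a m f + sumFrom (a + m) n f
sumFrom-+ a zero    n f = cong (λ b → sumFrom b n f) (sym (+-identityʳ a))
sumFrom-+ a (suc m) n f = begin
  f a + sumFrom (suc a) (m + n) f                       ≡⟨ cong (f a +_) (sumFrom-+ (suc a) m n f) ⟩
  f a + (sumFrom (suc a) m f + sumFrom (suc a + m) n f) ≡⟨ +-assoc (f a) _ _ ⟨
  prefix + sumFrom (suc a + m) n f                      ≡⟨ cong (λ b → prefix + sumFrom b n f) (+-suc a m) ⟨
  prefix + sumFrom (a + suc m) n f                      ∎
  where
  open ≡-Reasoning
  prefix = f a + sumFrom (suc a) m f

sumFrom-distrib-+ : ∀ a n f g → sumFrom a n (λ i → f i + g i) ≡ sumFrom a n f + sumFrom a n g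
sumFrom-distrib-+ a zero    f g = refl
sumFrom-distrib-+ a (suc n) f g = trans (cong (f a + g a +_) (sumFrom-distrib-+ (suc a) n f g))
                                        (interchange (f a) (g a) _ _)

*-distribˡ-sumFrom : ∀ c a n f → c * sumFrom a n f ≡ sumFrom a n (λ i → c * f i)
*-distribˡ-sumFrom c a zero    f = *-zeroʳ c
*-distribˡ-sumFrom c a (suc n) f =
  trans (*-distribˡ-+ c (f a) _) (cong (c * f a +_) (*-distribˡ-sumFrom c (suc a) n f))

sumFrom-comm : ∀ a m b n (F : ℕ → ℕ → ℕ) →
               sumFrom a m (λ i → sumFrom b n (F i)) ≡ sumFrom b n (λ j → sumFrom a m (λ i → F i j))
sumFrom-comm a zero    b n F = sym (sumFrom-≡0 {b} {n} λ _ _ _ → refl)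
sumFrom-comm a (suc m) b n F = trans (cong (sumFrom b n (F a) +_) (sumFrom-comm (suc a) m b n F))
                                     (sym (sumFrom-distrib-+ b n (F a) _))

sumFrom-suc : ∀ a n f → sumFrom (suc a) n f ≡ sumFrom a n (f ∘ suc)
sumFrom-suc a zero    f = refl
sumFrom-suc a (suc n) f = cong (f (suc a) +_) (sumFrom-suc (suc a) n f)

sum-applyUpTo : ∀ n f → sum (applyUpTo f n) ≡ sumFrom 0 n f
sum-applyUpTo zero    f = refl
sum-applyUpTo (suc n) f = cong (f 0 +_) (trans (sum-applyUpTo n (f ∘ suc)) (sym (sumFrom-suc 0 n f)))

count : Decidable P → ℕ → ℕ → ℕ
count P? a n = sumFrom a n (λ i → if does (P? i) then 1 else 0)

sumFrom-indicator : (P? : Decidable P) → ∀ a n c →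
                    sumFrom a n (λ i → if does (P? i) then c else 0) ≡ c * count P? a n
sumFrom-indicator P? a n c =
  sym (trans (*-distribˡ-sumFrom c a n _) (sumFrom-cong {a} {n} λ i _ _ → scale (does (P? i))))
  where
  scale : ∀ b → c * (if b then 1 else 0) ≡ (if b then c else 0)
  scale true  = *-identityʳ c
  scale false = *-zeroʳ c

count-markov : (P? : Decidable P) → ∀ {a n c f} → (∀ i → a ≤ i → i < a + n → P i → c ≤ f i) →
               c * count P? a n ≤ sumFrom a n f
count-markov P? {a} {n} {c} {f} P⇒c≤f = subst (_≤ sumFrom a n f) (sumFrom-indicator P? a n c)
  (sumFrom-mono-≤ {a} {n} λ i a≤i i<a+n → bound (P? i) (P⇒c≤f i a≤i i<a+n))
  where
  bound : ∀ {A : Set ℓ} {y} (p : Dec A) → (A → c ≤ y) → (if does p then c else 0) ≤ y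
  bound (yes p) c≤f = c≤f p
  bound (no _)  _   = z≤n

private
  range-suc : ∀ {R : Pred ℕ ℓ} {a n} →
              ∃[ i ] (suc a ≤ i × i < suc a + n × R i) → ∃[ i ] (a ≤ i × i < a + suc n × R i)
  range-suc {a = a} {n} (i , a<i , i<n , r) = i , <⇒≤ a<i , subst (i <_) (sym (+-suc a n)) i<n , r

count-pigeonhole : (P? : Decidable P) (Q? : Decidable Q) → ∀ a n → count P? a n + count Q? a n < n →
                   ∃[ i ] (a ≤ i × i < a + n × ¬ P i × ¬ Q i)
count-pigeonhole P? Q? a (suc n) lt with P? a | Q? a
... | no ¬p | no ¬q = a , ≤-refl , m<m+n a z<s , ¬p , ¬q
... | yes _ | _     = range-suc (count-pigeonhole P? Q? (suc a) n
                        (≤-<-trans (+-monoʳ-≤ (count P? (suc a) n) (m≤n+m _ _)) (≤-pred lt)))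
... | no _  | yes _ = range-suc (count-pigeonhole P? Q? (suc a) n
                        (≤-pred (subst (_< suc n) (+-suc (count P? (suc a) n) _) lt)))

module _ (P? : Decidable P) {e : ℕ} (separated : ∀ {i j} → P i → P j → i < j → i + suc e ≤ j) where

  private
    empty-window : ∀ {a i} → a ≤ i → i < a + 0 → ¬ P i
    empty-window {a} a≤i i<a+0 = contradiction a≤i (<⇒≱ (subst (_ <_) (+-identityʳ a) i<a+0))

    -- The first w positions of [a, a + n) are known to lie in the gap after a point of P.
    count-window : ∀ a n w → w ≤ e → (∀ i → a ≤ i → i < a + w → ¬ P i) →
                   count P? a n * suc e + w ≤ n + e
    count-window a zero    w w≤e _    = w≤e
    count-window a (suc n) w w≤e free = step (P? a) w w≤e free
      where
      step : (p : Dec (P a)) → ∀ w → w ≤ e → (∀ i → a ≤ i → i < a + w → ¬ P i) →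
             ((if does p then 1 else 0) + count P? (suc a) n) * suc e + w ≤ suc n + e
      step (yes pa) zero    _   _    = begin
        suc e + count P? (suc a) n * suc e + 0 ≡⟨ +-identityʳ _ ⟩
        suc e + count P? (suc a) n * suc e     ≤⟨ +-monoʳ-≤ (suc e) (+-cancelʳ-≤ e _ _ ih) ⟩
        suc e + n                              ≡⟨ cong suc (+-comm e n) ⟩
        suc n + e                              ∎
        where
        open ≤-Reasoning
        ih : count P? (suc a) n * suc e + e ≤ n + e
        ih = count-window (suc a) n e ≤-refl λ i a<i i<a+e pi →
               <⇒≱ (subst (i <_) (sym (+-suc a e)) i<a+e) (separated pa pi a<i)
      step (yes pa) (suc w) _   free = contradiction pa (free a ≤-refl (m<m+n a z<s))
      step (no _)   zero    _   _    = m≤n⇒m≤1+n (count-window (suc a) n zero z≤n λ _ → empty-window)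
      step (no _)   (suc w) w<e free = subst (_≤ suc n + e) (sym (+-suc _ w))
        (s≤s (count-window (suc a) n w (<⇒≤ w<e) λ i a<i i<a+w →
               free i (<⇒≤ a<i) (subst (i <_) (sym (+-suc a w)) i<a+w)))

  count-separated : ∀ a n → count P? a n ≤ n / suc e + 1
  count-separated a n = ≤-pred (subst (count P? a n <_) (+-suc (n / d) 1) (*-cancelʳ-< d _ _ (begin-strict
    count P? a n * d        ≤⟨ subst (_≤ n + e) (+-identityʳ _) (count-window a n 0 z≤n λ _ → empty-window) ⟩
    n + e                   ≡⟨ cong (_+ e) (trans (m≡m%n+[m/n]*n n d) (+-comm (n % d) _)) ⟩
    n / d * d + n % d + e   ≡⟨ +-assoc (n / d * d) (n % d) e ⟩
    n / d * d + (n % d + e) <⟨ +-monoʳ-< (n / d * d) (+-mono-≤-< n%d≤d (n<1+n e)) ⟩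
    n / d * d + (d + d)     ≡⟨ x*d+[d+d]≡[x+2]*d (n / d) d ⟩
    (n / d + 2) * d         ∎)))
    where
    open ≤-Reasoning
    d = suc e
    n%d≤d : n % d ≤ d
    n%d≤d = <⇒≤ (m%n<n n d)
    x*d+[d+d]≡[x+2]*d : ∀ x d → x * d + (d + d) ≡ (x + 2) * d
    x*d+[d+d]≡[x+2]*d = solve-∀

infixl 7 _div_

-- A total division, so that codivisors n div d can be summed over a range of d.
_div_ : ℕ → ℕ → ℕ
n div zero  = 0
n div suc d = n / suc d

div≡/ : ∀ m n .{{_ : NonZero n}} → m div n ≡ m / n
div≡/ m (suc n) = refl

div≤/ : ∀ m {d q} .{{_ : NonZero q}} → q ≤ d → m div d ≤ m / q
div≤/ m {zero}  _   = z≤n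
div≤/ m {suc d} q≤d = /-monoʳ-≤ m q≤d

sum-filter : (P? : Decidable P) → ∀ xs →
             sum (filter P? xs) ≡ sum (map (λ x → if does (P? x) then x else 0) xs)
sum-filter P? []       = refl
sum-filter P? (x ∷ xs) with does (P? x)
... | true  = cong (x +_) (sum-filter P? xs)
... | false = sum-filter P? xs

σ≡sumFrom : ∀ n → σ n ≡ sumFrom 1 n (λ d → if does (d ∣? n) then d else 0)
σ≡sumFrom n = begin
  σ n                                    ≡⟨ sum-filter (_∣? n) (map suc (upTo n)) ⟩
  sum (map divisor (map suc (upTo n)))   ≡⟨ cong sum (sym (map-∘ (upTo n))) ⟩
  sum (map (divisor ∘ suc) (upTo n))     ≡⟨ cong sum (map-upTo (divisor ∘ suc) n) ⟩
  sum (applyUpTo (divisor ∘ suc) n)      ≡⟨ sum-applyUpTo n (divisor ∘ suc) ⟩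
  sumFrom 0 n (divisor ∘ suc)            ≡⟨ sumFrom-suc 0 n divisor ⟨
  sumFrom 1 n divisor                    ∎
  where
  open ≡-Reasoning
  divisor : ℕ → ℕ
  divisor d = if does (d ∣? n) then d else 0

private
  if-no : ∀ {A : Set ℓ} {x} (p : Dec A) → ¬ A → (if does p then x else 0) ≡ 0
  if-no p ¬a = cong (λ b → if b then _ else 0) (dec-false p ¬a)

  if-yes : ∀ {A : Set ℓ} {x} (p : Dec A) → A → (if does p then x else 0) ≡ x
  if-yes p a = cong (λ b → if b then _ else 0) (dec-true p a)

  if-⇔ : ∀ {A B : Set ℓ} {x} (p : Dec A) (r : Dec B) → (A → B) → (B → A) →
         (if does p then x else 0) ≡ (if does r then x else 0)
  if-⇔ (yes _) (yes _) _   _   = refl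
  if-⇔ (no _)  (no _)  _   _   = refl
  if-⇔ (yes a) (no ¬b) a→b _   = contradiction (a→b a) ¬b
  if-⇔ (no ¬a) (yes b) _   b→a = contradiction (b→a b) ¬a

sumFrom-delta : ∀ a n q (g : ℕ → ℕ) → a ≤ q → q < a + n →
                sumFrom a n (λ i → if does (i ≟ q) then g i else 0) ≡ g q
sumFrom-delta a zero    q g a≤q q<a+0 = contradiction a≤q (<⇒≱ (subst (q <_) (+-identityʳ a) q<a+0))
sumFrom-delta a (suc n) q g a≤q q<a+n = step (a ≟ q)
  where
  step : (p : Dec (a ≡ q)) →
         (if does p then g a else 0) + sumFrom (suc a) n (λ i → if does (i ≟ q) then g i else 0) ≡ g q
  step (yes refl) = trans (cong (g a +_) (sumFrom-≡0 {suc a} {n} λ i a<i _ →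
                                           if-no (i ≟ a) λ { refl → <-irrefl refl a<i }))
                          (+-identityʳ (g a))
  step (no a≢q)   = sumFrom-delta (suc a) n q g (≤∧≢⇒< a≤q a≢q) (subst (q <_) (+-suc a n) q<a+n)

sumFrom-cofactor : ∀ {n V y} (g : ℕ → ℕ) → 0 < n → n ≤ V → 0 < y →
  sumFrom 1 V (λ x → if does (x * y ≟ n) then g x else 0) ≡ (if does (y ∣? n) then g (n div y) else 0)
sumFrom-cofactor {n} {V} {y@(suc _)} g 0<n n≤V _ = step (y ∣? n)
  where
  step : (p : Dec (y ∣ n)) →
         sumFrom 1 V (λ x → if does (x * y ≟ n) then g x else 0) ≡ (if does p then g (n div y) else 0)
  step (no y∤n) = sumFrom-≡0 {1} {V} λ x _ _ → if-no (x * y ≟ n) λ x*y≡n → y∤n (divides x (sym x*y≡n))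
  step (yes (divides q n≡q*y)) = begin
    sumFrom 1 V (λ x → if does (x * y ≟ n) then g x else 0) ≡⟨ sumFrom-cong {1} {V} (λ x _ _ → same x) ⟩
    sumFrom 1 V (λ x → if does (x ≟ q) then g x else 0)     ≡⟨ sumFrom-delta 1 V q g 1≤q (s≤s q≤V) ⟩
    g q                                                     ≡⟨ cong g n/y≡q ⟨
    g (n div y)                                             ∎
    where
    open ≡-Reasoning
    same : ∀ x → (if does (x * y ≟ n) then g x else 0) ≡ (if does (x ≟ q) then g x else 0)
    same x = if-⇔ (x * y ≟ n) (x ≟ q) (λ x*y≡n → *-cancelʳ-≡ x q y (trans x*y≡n n≡q*y))
                                      (λ { refl → sym n≡q*y })
    n/y≡q : n div y ≡ q
    n/y≡q = trans (cong (_/ y) n≡q*y) (m*n/n≡m q y)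
    1≤q : 1 ≤ q
    1≤q = n≢0⇒n>0 λ { refl → >⇒≢ 0<n n≡q*y }
    q≤V : q ≤ V
    q≤V = ≤-trans (subst (q ≤_) (sym n≡q*y) (m≤m*n q y)) n≤V

σ≡sumFrom-codivisors : ∀ {n V} → 0 < n → n ≤ V →
                       σ n ≡ sumFrom 1 V (λ d → if does (d ∣? n) then n div d else 0)
σ≡sumFrom-codivisors {n} {V} 0<n n≤V = begin
  σ n                                                   ≡⟨ σ≡sumFrom n ⟩
  sumFrom 1 n divisor                                   ≡⟨ +-identityʳ _ ⟨
  sumFrom 1 n divisor + 0                               ≡⟨ cong (sumFrom 1 n divisor +_) beyond-n ⟨
  sumFrom 1 n divisor + sumFrom (suc n) (V ∸ n) divisor ≡⟨ sumFrom-+ 1 n (V ∸ n) divisor ⟨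
  sumFrom 1 (n + (V ∸ n)) divisor                       ≡⟨ cong (λ l → sumFrom 1 l divisor) (m+[n∸m]≡n n≤V) ⟩
  sumFrom 1 V divisor                                   ≡⟨ sumFrom-cong {1} {V} (λ i 1≤i _ → sym (row i 1≤i)) ⟩
  sumFrom 1 V (λ i → sumFrom 1 V (pairs i))             ≡⟨ sumFrom-comm 1 V 1 V pairs ⟩
  sumFrom 1 V (λ j → sumFrom 1 V (λ i → pairs i j))     ≡⟨ sumFrom-cong {1} {V} (λ j 1≤j _ → column j 1≤j) ⟩
  sumFrom 1 V (λ d → if does (d ∣? n) then n div d else 0) ∎
  where
  open ≡-Reasoning
  divisor : ℕ → ℕ
  divisor d = if does (d ∣? n) then d else 0
  pairs : ℕ → ℕ → ℕ
  pairs i j = if does (i * j ≟ n) then i else 0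
  beyond-n : sumFrom (suc n) (V ∸ n) divisor ≡ 0
  beyond-n = sumFrom-≡0 {suc n} {V ∸ n} λ d n<d _ →
               if-no (d ∣? n) λ d∣n → <⇒≱ n<d (∣⇒≤ {{>-nonZero 0<n}} d∣n)
  row : ∀ i → 0 < i → sumFrom 1 V (pairs i) ≡ divisor i
  row i 0<i = trans (sumFrom-cong {1} {V} λ j _ _ → if-⇔ (i * j ≟ n) (j * i ≟ n) (trans (*-comm j i))
                                                                                  (trans (*-comm i j)))
                    (sumFrom-cofactor (λ _ → i) 0<n n≤V 0<i)
  column : ∀ j → 0 < j → sumFrom 1 V (λ i → pairs i j) ≡ (if does (j ∣? n) then n div j else 0)
  column j 0<j = sumFrom-cofactor (λ i → i) 0<n n≤V 0<j

*-distribˡ-sum : ∀ t ds → t * sum ds ≡ sum (map (t *_) ds)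
*-distribˡ-sum t []       = *-zeroʳ t
*-distribˡ-sum t (d ∷ ds) = trans (*-distribˡ-+ t d (sum ds)) (cong (t * d +_) (*-distribˡ-sum t ds))

sumFrom-sum-comm : ∀ a n (F : ℕ → ℕ → ℕ) vs →
                   sumFrom a n (λ x → sum (map (F x) vs)) ≡
                   sum (map (λ v → sumFrom a n (λ x → F x v)) vs)
sumFrom-sum-comm a n F []       = sumFrom-≡0 {a} {n} λ _ _ _ → refl
sumFrom-sum-comm a n F (v ∷ vs) = trans (sumFrom-distrib-+ a n (λ x → F x v) _)
                                        (cong (sumFrom a n (λ x → F x v) +_) (sumFrom-sum-comm a n F vs))

sum≤σ : ∀ {n ds} → 0 < n → Unique ds → All (_∣ n) ds → sum ds ≤ σ n
sum≤σ {n} {ds} 0<n unique ds∣n = begin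
  sum ds                                             ≡⟨ as-deltas ds ds∣n ⟩
  sum (map (λ v → sumFrom 1 n (δ v)) ds)             ≡⟨ sumFrom-sum-comm 1 n (λ x v → δ v x) ds ⟨
  sumFrom 1 n (λ x → sum (map (λ v → δ v x) ds))     ≤⟨ sumFrom-mono-≤ {1} {n} (λ x _ _ →
                                                          at-most-once x ds unique ds∣n) ⟩
  sumFrom 1 n (λ x → if does (x ∣? n) then x else 0) ≡⟨ σ≡sumFrom n ⟨
  σ n                                                ∎
  where
  open ≤-Reasoning
  δ : ℕ → ℕ → ℕ
  δ v x = if does (x ≟ v) then x else 0

  as-deltas : ∀ vs → All (_∣ n) vs → sum vs ≡ sum (map (λ v → sumFrom 1 n (δ v)) vs)
  as-deltas []       []           = refl
  as-deltas (v ∷ vs) (v∣n ∷ vs∣n) = cong₂ _+_ (sym (sumFrom-delta 1 n v (λ x → x) 1≤v (s≤s v≤n)))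
                                             (as-deltas vs vs∣n)
    where
    1≤v : 1 ≤ v
    1≤v = n≢0⇒n>0 λ { refl → >⇒≢ 0<n (0∣⇒≡0 v∣n) }
    v≤n : v ≤ n
    v≤n = ∣⇒≤ {{>-nonZero 0<n}} v∣n

  elsewhere : ∀ x vs → All (x ≢_) vs → sum (map (λ v → δ v x) vs) ≡ 0
  elsewhere x []       []           = refl
  elsewhere x (v ∷ vs) (x≢v ∷ x∉vs) = cong₂ _+_ (if-no (x ≟ v) x≢v) (elsewhere x vs x∉vs)

  at-most-once : ∀ x vs → Unique vs → All (_∣ n) vs →
                 sum (map (λ v → δ v x) vs) ≤ (if does (x ∣? n) then x else 0)
  at-most-once x []       []             []           = z≤n
  at-most-once x (v ∷ vs) (v∉vs ∷ uniq) (v∣n ∷ vs∣n) = step (x ≟ v)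
    where
    step : (p : Dec (x ≡ v)) →
           (if does p then x else 0) + sum (map (λ w → δ w x) vs) ≤ (if does (x ∣? n) then x else 0)
    step (yes refl) = ≤-reflexive (trans (cong (x +_) (elsewhere x vs v∉vs))
                                         (trans (+-identityʳ x) (sym (if-yes (x ∣? n) v∣n))))
    step (no _)     = at-most-once x vs uniq vs∣n

*-sum≤σ : ∀ {n t ds} → 0 < n → 0 < t → Unique ds → All (_∣ n) ds → t * sum ds ≤ σ (n * t)
*-sum≤σ {n} {t} {ds} 0<n 0<t unique ds∣n = subst (_≤ σ (n * t)) (sym (*-distribˡ-sum t ds))
  (sum≤σ (*-mono-< 0<n 0<t) (Unique.map⁺ (*-cancelˡ-≡ _ _ t {{>-nonZero 0<t}}) unique)
         (All.map⁺ (All.map (λ {d} d∣n → subst (t * d ∣_) (*-comm t n) (*-monoʳ-∣ t d∣n)) ds∣n)))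

sumFrom-dyadic-block : ∀ A L q .{{_ : NonZero q}} →
                       sumFrom q q (λ d → A div d * (L div d + 1)) ≤ A * (L / q + 1)
sumFrom-dyadic-block A L q = begin
  sumFrom q q (λ d → A div d * (L div d + 1)) ≤⟨ sumFrom-mono-≤ {q} {q} (λ d q≤d _ →
                                                   *-mono-≤ (div≤/ A q≤d) (+-monoˡ-≤ 1 (div≤/ L q≤d))) ⟩
  sumFrom q q (λ _ → A / q * (L / q + 1))     ≡⟨ sumFrom-const q q _ ⟩
  q * (A / q * (L / q + 1))                   ≡⟨ *-assoc q (A / q) _ ⟨
  q * (A / q) * (L / q + 1)                   ≤⟨ *-monoˡ-≤ (L / q + 1) q*[A/q]≤A ⟩
  A * (L / q + 1)                             ∎
  where
  open ≤-Reasoning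
  q*[A/q]≤A : q * (A / q) ≤ A
  q*[A/q]≤A = subst (_≤ A) (*-comm (A / q) q) (m/n*n≤m A q)

sumFrom-dyadic : ∀ A L k s →
  sumFrom (2 ^ k) (2 ^ (s + k) ∸ 2 ^ k) (λ d → A div d * (L div d + 1)) ≤ A * (2 * (L div 2 ^ k) + s)
sumFrom-dyadic A L k s = ≤-trans (m≤m+n _ _) (go s)
  where
  G : ℕ → ℕ
  G d = A div d * (L div d + 1)
  go : ∀ s → sumFrom (2 ^ k) (2 ^ (s + k) ∸ 2 ^ k) G + A * (2 * (L div 2 ^ (s + k))) ≤
             A * (2 * (L div 2 ^ k) + s)
  go zero = ≤-reflexive (begin-equality
    sumFrom (2 ^ k) (2 ^ k ∸ 2 ^ k) G + A * (2 * (L div 2 ^ k))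
      ≡⟨ cong (λ l → sumFrom (2 ^ k) l G + A * (2 * (L div 2 ^ k))) (n∸n≡0 (2 ^ k)) ⟩
    A * (2 * (L div 2 ^ k))
      ≡⟨ cong (A *_) (+-identityʳ _) ⟨
    A * (2 * (L div 2 ^ k) + 0) ∎)
    where open ≤-Reasoning
  go (suc s) = begin
    sumFrom (2 ^ k) (2 * q ∸ 2 ^ k) G + A * (2 * (L div (2 * q)))
      ≡⟨ cong (λ l → sumFrom (2 ^ k) l G + A * (2 * (L div (2 * q)))) length ⟩
    sumFrom (2 ^ k) ((q ∸ 2 ^ k) + q) G + A * (2 * (L div (2 * q)))
      ≡⟨ cong (_+ A * (2 * (L div (2 * q)))) (trans (sumFrom-+ (2 ^ k) (q ∸ 2 ^ k) q G)
                                                   (cong (λ a → S + sumFrom a q G) (m+[n∸m]≡n 2^k≤q))) ⟩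
    S + sumFrom q q G + A * (2 * (L div (2 * q)))
      ≤⟨ +-mono-≤ (+-monoʳ-≤ S (sumFrom-dyadic-block A L q)) (*-monoʳ-≤ A halve) ⟩
    S + A * (L / q + 1) + A * (L / q)
      ≡⟨ rearrange S A (L / q) ⟩
    S + A * (2 * (L / q)) + A
      ≤⟨ +-monoˡ-≤ A (subst (λ y → S + A * (2 * y) ≤ A * (2 * (L div 2 ^ k) + s)) (div≡/ L q) (go s)) ⟩
    A * (2 * (L div 2 ^ k) + s) + A
      ≡⟨ distribute A (2 * (L div 2 ^ k)) s ⟩
    A * (2 * (L div 2 ^ k) + suc s) ∎
    where
    open ≤-Reasoning
    q : ℕ
    q = 2 ^ (s + k)
    S : ℕ
    S = sumFrom (2 ^ k) (q ∸ 2 ^ k) G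
    instance
      q-nonZero : NonZero q
      q-nonZero = m^n≢0 2 (s + k)
      2q-nonZero : NonZero (2 * q)
      2q-nonZero = m*n≢0 2 q
      q2-nonZero : NonZero (q * 2)
      q2-nonZero = m*n≢0 q 2
    2^k≤q : 2 ^ k ≤ q
    2^k≤q = ^-monoʳ-≤ 2 (m≤n+m k s)
    length : 2 * q ∸ 2 ^ k ≡ (q ∸ 2 ^ k) + q
    length = trans (cong (λ x → (q + x) ∸ 2 ^ k) (+-identityʳ q)) (+-∸-comm q 2^k≤q)
    halve : 2 * (L div (2 * q)) ≤ L / q
    halve = begin
      2 * (L div (2 * q)) ≡⟨ cong (2 *_) (div≡/ L (2 * q)) ⟩
      2 * (L / (2 * q))   ≡⟨ cong (2 *_) (/-congʳ (*-comm 2 q)) ⟩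
      2 * (L / (q * 2))   ≡⟨ cong (2 *_) (m/n/o≡m/[n*o] L q 2) ⟨
      2 * (L / q / 2)     ≡⟨ *-comm 2 (L / q / 2) ⟩
      L / q / 2 * 2       ≤⟨ m/n*n≤m (L / q) 2 ⟩
      L / q               ∎
    rearrange : ∀ S A y → S + A * (y + 1) + A * y ≡ S + A * (2 * y) + A
    rearrange = solve-∀
    distribute : ∀ A x s → A * (x + s) + A ≡ A * (x + suc s)
    distribute = solve-∀

aliquot : ℕ → ℕ
aliquot n = σ n ∸ n

≤-aliquot : ∀ {n y} → n + y ≤ σ n → y ≤ aliquot n
≤-aliquot {n} {y} n+y≤σn = subst (_≤ aliquot n) (m+n∸m≡n n y) (∸-monoˡ-≤ n n+y≤σn)

aliquot≤sum-large-codivisors : ∀ {n A} k s → 0 < n → n ≤ A → A < 2 ^ (s + k) →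
  (∀ {d} → 1 < d → d < 2 ^ k → ¬ d ∣ n) →
  aliquot n ≤ sumFrom (2 ^ k) (2 ^ (s + k) ∸ 2 ^ k) (λ d → if does (d ∣? n) then A div d else 0)
aliquot≤sum-large-codivisors {n} {A} k s 0<n n≤A A<2^s+k no-small = begin
  σ n ∸ n                                              ≤⟨ ∸-monoˡ-≤ n σn≤ ⟩
  n + sumFrom (2 ^ k) D large ∸ n                      ≡⟨ m+n∸m≡n n _ ⟩
  sumFrom (2 ^ k) D large                              ∎
  where
  open ≤-Reasoning
  D = 2 ^ (s + k) ∸ 2 ^ k
  codivisor large : ℕ → ℕ
  codivisor d = if does (d ∣? n) then n div d else 0
  large     d = if does (d ∣? n) then A div d else 0
  1≤2^k : 1 ≤ 2 ^ k
  1≤2^k = m^n>0 2 k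
  2^k≤2^s+k : 2 ^ k ≤ 2 ^ (s + k)
  2^k≤2^s+k = ^-monoʳ-≤ 2 (m≤n+m k s)
  split : (2 ^ k ∸ 1) + D ≡ 2 ^ (s + k) ∸ 1
  split = begin-equality
    (2 ^ k ∸ 1) + D           ≡⟨ +-comm (2 ^ k ∸ 1) D ⟩
    D + (2 ^ k ∸ 1)           ≡⟨ +-∸-assoc D 1≤2^k ⟨
    D + 2 ^ k ∸ 1             ≡⟨ cong (_∸ 1) (m∸n+n≡m 2^k≤2^s+k) ⟩
    2 ^ (s + k) ∸ 1           ∎
  small : ∀ l → 1 + l ≤ 2 ^ k → sumFrom 1 l codivisor ≤ n
  small zero    _       = z≤n
  small (suc l) 2+l≤2^k = ≤-reflexive (begin-equality
    codivisor 1 + sumFrom 2 l codivisor ≡⟨ cong₂ _+_ (trans (if-yes (1 ∣? n) (1∣ n)) (n/1≡n n))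
                                                      (sumFrom-≡0 {2} {l} λ d 1<d d<2+l →
                                                         if-no (d ∣? n) (no-small 1<d (<-≤-trans d<2+l 2+l≤2^k))) ⟩
    n + 0                               ≡⟨ +-identityʳ n ⟩
    n                                   ∎)
  codivisor≤large : ∀ d b → (if b then n div d else 0) ≤ (if b then A div d else 0)
  codivisor≤large d       false = z≤n
  codivisor≤large zero    true  = z≤n
  codivisor≤large (suc d) true  = /-monoˡ-≤ (suc d) n≤A
  σn≤ : σ n ≤ n + sumFrom (2 ^ k) D large
  σn≤ = begin
    σ n
      ≡⟨ σ≡sumFrom-codivisors 0<n (<⇒≤pred (≤-<-trans n≤A A<2^s+k)) ⟩
    sumFrom 1 (2 ^ (s + k) ∸ 1) codivisor
      ≡⟨ cong (λ l → sumFrom 1 l codivisor) split ⟨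
    sumFrom 1 ((2 ^ k ∸ 1) + D) codivisor
      ≡⟨ sumFrom-+ 1 (2 ^ k ∸ 1) D codivisor ⟩
    sumFrom 1 (2 ^ k ∸ 1) codivisor + sumFrom (1 + (2 ^ k ∸ 1)) D codivisor
      ≡⟨ cong (λ a → sumFrom 1 (2 ^ k ∸ 1) codivisor + sumFrom a D codivisor) (m+[n∸m]≡n 1≤2^k) ⟩
    sumFrom 1 (2 ^ k ∸ 1) codivisor + sumFrom (2 ^ k) D codivisor
      ≤⟨ +-mono-≤ (small (2 ^ k ∸ 1) (≤-reflexive (m+[n∸m]≡n 1≤2^k)))
                  (sumFrom-mono-≤ {2 ^ k} {D} λ d _ _ → codivisor≤large d (does (d ∣? n))) ⟩
    n + sumFrom (2 ^ k) D large ∎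

module _ {α β k : ℕ} (0<α : 0 < α) (coprime : Coprime α β)
         (small∣β : ∀ {d} → 1 < d → d < 2 ^ k → d ∣ β) where

  private
    ∣α : ∀ {i x} → i ∣ α + β * x → i ∣ β → i ∣ α
    ∣α {i} {x} i∣αβx i∣β =
      ∣m+n∣m⇒∣n (subst (i ∣_) (+-comm α (β * x)) i∣αβx) (∣m⇒∣m*n x i∣β)

    divisor-coprime : ∀ {d x} → d ∣ α + β * x → Coprime d β
    divisor-coprime d∣αβx (i∣d , i∣β) = coprime (∣α (∣-trans i∣d d∣αβx) i∣β , i∣β)

    no-small-divisor : ∀ {d x} → 1 < d → d < 2 ^ k → ¬ d ∣ α + β * x
    no-small-divisor 1<d d<2^k d∣αβx = >⇒≢ 1<d (coprime (∣α d∣αβx d∣β , d∣β))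
      where d∣β = small∣β 1<d d<2^k

    separated : ∀ {d x y} → 0 < d → d ∣ α + β * x → d ∣ α + β * y → x < y → x + d ≤ y
    separated {d} {x} {y} 0<d d∣αβx d∣αβy x<y = begin
      x + d       ≤⟨ +-monoʳ-≤ x (∣⇒≤ {{>-nonZero (m<n⇒0<n∸m x<y)}} d∣y-x) ⟩
      x + (y ∸ x) ≡⟨ m+[n∸m]≡n (<⇒≤ x<y) ⟩
      y           ∎
      where
      open ≤-Reasoning
      step : α + β * y ≡ (α + β * x) + β * (y ∸ x)
      step = trans (cong (λ z → α + β * z) (sym (m+[n∸m]≡n (<⇒≤ x<y))))
                   (trans (cong (α +_) (*-distribˡ-+ β x (y ∸ x))) (sym (+-assoc α _ _)))
      d∣y-x : d ∣ y ∸ x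
      d∣y-x = coprime-divisor (divisor-coprime d∣αβx)
                              (∣m+n∣m⇒∣n (subst (d ∣_) step d∣αβy) d∣αβx)

  sumFrom-aliquot≤ : ∀ c L s → α + β * (c + L) < 2 ^ (s + k) →
    sumFrom c L (λ x → aliquot (α + β * x)) ≤ (α + β * (c + L)) * (2 * (L div 2 ^ k) + s)
  sumFrom-aliquot≤ c L s A<2^s+k = begin
    sumFrom c L (λ x → aliquot (α + β * x))
      ≤⟨ sumFrom-mono-≤ {c} {L} (λ x _ x<c+L →
           aliquot≤sum-large-codivisors k s (≤-trans 0<α (m≤m+n α _))
                                        (+-monoʳ-≤ α (*-monoʳ-≤ β (<⇒≤ x<c+L))) A<2^s+k no-small-divisor) ⟩
    sumFrom c L (λ x → sumFrom (2 ^ k) D (λ d → if does (d ∣? α + β * x) then A div d else 0))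
      ≡⟨ sumFrom-comm c L (2 ^ k) D _ ⟩
    sumFrom (2 ^ k) D (λ d → sumFrom c L (λ x → if does (d ∣? α + β * x) then A div d else 0))
      ≡⟨ sumFrom-cong {2 ^ k} {D} (λ d _ _ → sumFrom-indicator (λ x → d ∣? α + β * x) c L (A div d)) ⟩
    sumFrom (2 ^ k) D (λ d → A div d * count (λ x → d ∣? α + β * x) c L)
      ≤⟨ sumFrom-mono-≤ {2 ^ k} {D} (λ d 2^k≤d _ →
           *-monoʳ-≤ (A div d) (count-multiples d c L (≤-trans (m^n>0 2 k) 2^k≤d))) ⟩
    sumFrom (2 ^ k) D (λ d → A div d * (L div d + 1))
      ≤⟨ sumFrom-dyadic A L k s ⟩
    A * (2 * (L div 2 ^ k) + s) ∎
    where
    open ≤-Reasoning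
    A = α + β * (c + L)
    D = 2 ^ (s + k) ∸ 2 ^ k
    count-multiples : ∀ d c L → 0 < d → count (λ x → d ∣? α + β * x) c L ≤ L div d + 1
    count-multiples (suc e) c L 0<d = count-separated (λ x → suc e ∣? α + β * x) (separated 0<d) c L

n<2^n : ∀ n → n < 2 ^ n
n<2^n zero    = z<s
n<2^n (suc n) = subst (_< 2 ^ suc n) (+-comm n 1)
  (+-mono-<-≤ (n<2^n n) (subst (1 ≤_) (sym (+-identityʳ (2 ^ n))) (m^n>0 2 n)))

module _ {α β c s₀ : ℕ} (0<α : 0 < α) (coprime : Coprime α β)
         (small∣β : ∀ {d} → 1 < d → d < 256 → d ∣ β)
         (P? : Decidable P) (P⇒large-aliquot : ∀ x → P x → c * x ≤ aliquot (α + β * x))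
         (X<2^s₀+8 : α + 512 * β < 2 ^ (s₀ + 8)) (X<8192c : α + 512 * β < 8192 * c) where

  -- With H = 2 ^ h and L = 256 H, every α + β x with x < 2 L is at most (α + 512 β) H, and
  -- Markov's inequality bounds the number of exceptions in [L, 2 L) by (α + 512 β) H / (64 c).
  few-exceptions : ∀ h → s₀ ≤ 2 ^ h → count P? (256 * 2 ^ h) (256 * 2 ^ h) < 128 * 2 ^ h
  few-exceptions h s₀≤H = *-cancelʳ-< _ _ _ (begin-strict
    count P? L L * (c * L)                  ≡⟨ *-comm (count P? L L) (c * L) ⟩
    c * L * count P? L L                    ≤⟨ count-markov P? {L} {L} (λ x L≤x _ Px →
                                                 ≤-trans (*-monoʳ-≤ c L≤x) (P⇒large-aliquot x Px)) ⟩
    sumFrom L L (λ x → aliquot (α + β * x)) ≤⟨ sumFrom-aliquot≤ 0<α coprime small∣β L L (h + s₀) A<2^s+8 ⟩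
    A * (2 * (L div 256) + (h + s₀))        ≤⟨ *-mono-≤ A≤XH (subst (λ y → 2 * y + (h + s₀) ≤ 4 * H)
                                                                   (sym L/256≡H) h+s₀≤2H) ⟩
    X * H * (4 * H)                         ≡⟨ regroup X H ⟩
    X * (4 * (H * H))                       <⟨ *-monoˡ-< (4 * (H * H)) X<8192c ⟩
    8192 * c * (4 * (H * H))                ≡⟨ rescale c H ⟩
    128 * H * (c * L)                       ∎)
    where
    open ≤-Reasoning
    H = 2 ^ h
    L = 256 * H
    X = α + 512 * β
    A = α + β * (L + L)
    regroup : ∀ X H → X * H * (4 * H) ≡ X * (4 * (H * H))
    regroup = solve-∀
    rescale : ∀ c H → 8192 * c * (4 * (H * H)) ≡ 128 * H * (c * (256 * H))
    rescale = solve-∀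
    double : ∀ α β H → α + β * (256 * H + 256 * H) ≡ α + 512 * β * H
    double = solve-∀
    exponent : ∀ s₀ h → s₀ + 8 + h ≡ h + s₀ + 8
    exponent = solve-∀
    quadruple : ∀ H → 2 * H + (H + H) ≡ 4 * H
    quadruple = solve-∀
    instance
      H-nonZero : NonZero H
      H-nonZero = m^n≢0 2 h
      H²-nonZero : NonZero (H * H)
      H²-nonZero = m*n≢0 H H
      4H²-nonZero : NonZero (4 * (H * H))
      4H²-nonZero = m*n≢0 4 (H * H)
    A≤XH : A ≤ X * H
    A≤XH = begin
      α + β * (L + L)     ≡⟨ double α β H ⟩
      α + 512 * β * H     ≤⟨ +-monoˡ-≤ (512 * β * H) (m≤m*n α H) ⟩
      α * H + 512 * β * H ≡⟨ *-distribʳ-+ H α (512 * β) ⟨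
      X * H               ∎
    A<2^s+8 : A < 2 ^ ((h + s₀) + 8)
    A<2^s+8 = begin-strict
      A                   ≤⟨ A≤XH ⟩
      X * H               <⟨ *-monoˡ-< H X<2^s₀+8 ⟩
      2 ^ (s₀ + 8) * H    ≡⟨ ^-distribˡ-+-* 2 (s₀ + 8) h ⟨
      2 ^ (s₀ + 8 + h)    ≡⟨ cong (2 ^_) (exponent s₀ h) ⟩
      2 ^ (h + s₀ + 8)    ∎
    L/256≡H : L div 256 ≡ H
    L/256≡H = trans (cong (_div 256) (*-comm 256 H)) (m*n/n≡m H 256)
    h+s₀≤2H : 2 * H + (h + s₀) ≤ 4 * H
    h+s₀≤2H = begin
      2 * H + (h + s₀)    ≤⟨ +-monoʳ-≤ (2 * H) (+-mono-≤ (<⇒≤ (n<2^n h)) s₀≤H) ⟩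
      2 * H + (H + H)     ≡⟨ quadruple H ⟩
      4 * H               ∎

module Construction
  (K r u₀ E : ℕ) (ds : List ℕ) (ds-unique : Unique ds) (ds∣K : All (_∣ K) ds)
  (sum-ds : sum ds ≡ 3 * K + 2 + E)
  (2r+5≡15K : 2 * r + 5 ≡ 15 * K) (5r+4≡16u₀ : 5 * r + 4 ≡ 16 * u₀) (3≤u₀ : 3 ≤ u₀)
  where

  m t u : ℕ → ℕ
  m x = r + 128 * K * x
  t x = 15 + 256 * x
  u x = u₀ + 40 * K * x

  0<K : 0 < K
  0<K = n≢0⇒n>0 λ { refl → contradiction (m+n≡0⇒n≡0 (2 * r) 2r+5≡15K) λ () }

  2m+5≡K*t : ∀ x → 2 * m x + 5 ≡ K * t x
  2m+5≡K*t x = begin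
    2 * m x + 5               ≡⟨ expand r K x ⟩
    2 * r + 5 + K * (256 * x) ≡⟨ cong (_+ K * (256 * x)) 2r+5≡15K ⟩
    15 * K + K * (256 * x)    ≡⟨ factor K x ⟩
    K * t x                   ∎
    where
    open ≡-Reasoning
    expand : ∀ r K x → 2 * (r + 128 * K * x) + 5 ≡ 2 * r + 5 + K * (256 * x)
    expand = solve-∀
    factor : ∀ K x → 15 * K + K * (256 * x) ≡ K * (15 + 256 * x)
    factor = solve-∀

  5m+4≡16u : ∀ x → 5 * m x + 4 ≡ 16 * u x
  5m+4≡16u x = begin
    5 * m x + 4                   ≡⟨ expand r K x ⟩
    5 * r + 4 + 16 * (40 * K * x) ≡⟨ cong (_+ 16 * (40 * K * x)) 5r+4≡16u₀ ⟩
    16 * u₀ + 16 * (40 * K * x)   ≡⟨ *-distribˡ-+ 16 u₀ (40 * K * x) ⟨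
    16 * u x                      ∎
    where
    open ≡-Reasoning
    expand : ∀ r K x → 5 * (r + 128 * K * x) + 4 ≡ 5 * r + 4 + 16 * (40 * K * x)
    expand = solve-∀

  β : ℕ
  β = 768 * K

  6m+c≡ : ∀ c x → 6 * m x + c ≡ 6 * r + c + β * x
  6m+c≡ c x = expand c r K x
    where
    expand : ∀ c r K x → 6 * (r + 128 * K * x) + c ≡ 6 * r + c + 768 * K * x
    expand = solve-∀

  FirstFails SecondFails : ℕ → Set
  FirstFails  x = σ (2 * m x + 5) ≤ σ (6 * m x + 17)
  SecondFails x = σ (5 * m x + 4) ≤ σ (6 * m x + 7)

  first-fails? : Decidable FirstFails
  first-fails? x = σ (2 * m x + 5) ≤? σ (6 * m x + 17)

  second-fails? : Decidable SecondFails
  second-fails? x = σ (5 * m x + 4) ≤? σ (6 * m x + 7)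

  first-fails⇒large-aliquot : ∀ x → FirstFails x → 256 * E * x ≤ aliquot (6 * r + 17 + β * x)
  first-fails⇒large-aliquot x fails = begin
    256 * E * x                  ≡⟨ cong (_* x) (*-comm 256 E) ⟩
    E * 256 * x                  ≡⟨ *-assoc E 256 x ⟩
    E * (256 * x)                ≤⟨ *-monoʳ-≤ E (m≤n+m (256 * x) 15) ⟩
    E * T                        ≤⟨ ≤-aliquot {6 * m x + 17} chain ⟩
    aliquot (6 * m x + 17)       ≡⟨ cong aliquot (6m+c≡ 17 x) ⟩
    aliquot (6 * r + 17 + β * x) ∎
    where
    open ≤-Reasoning
    T = t x
    0<T : 0 < T
    0<T = z<s
    triple : ∀ y → 6 * y + 17 ≡ 3 * (2 * y + 5) + 2
    triple = solve-∀
    factor : ∀ K T E → 3 * (K * T) + 2 * T + E * T ≡ T * (3 * K + 2 + E)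
    factor = solve-∀
    chain : 6 * m x + 17 + E * T ≤ σ (6 * m x + 17)
    chain = begin
      6 * m x + 17 + E * T        ≡⟨ cong (_+ E * T) (triple (m x)) ⟩
      3 * (2 * m x + 5) + 2 + E * T ≡⟨ cong (λ n → 3 * n + 2 + E * T) (2m+5≡K*t x) ⟩
      3 * (K * T) + 2 + E * T     ≤⟨ +-monoˡ-≤ (E * T) (+-monoʳ-≤ (3 * (K * T)) (*-monoʳ-≤ 2 0<T)) ⟩
      3 * (K * T) + 2 * T + E * T ≡⟨ factor K T E ⟩
      T * (3 * K + 2 + E)         ≡⟨ cong (T *_) sum-ds ⟨
      T * sum ds                  ≤⟨ *-sum≤σ 0<K 0<T ds-unique ds∣K ⟩
      σ (K * T)                   ≡⟨ cong σ (2m+5≡K*t x) ⟨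
      σ (2 * m x + 5)             ≤⟨ fails ⟩
      σ (6 * m x + 17)            ∎

  second-fails⇒large-aliquot : ∀ x → SecondFails x → 440 * K * x ≤ aliquot (6 * r + 7 + β * x)
  second-fails⇒large-aliquot x fails = begin
    440 * K * x                 ≡⟨ reassociate K x ⟩
    11 * (40 * K * x)           ≤⟨ *-monoʳ-≤ 11 (m≤n+m (40 * K * x) u₀) ⟩
    11 * U                      ≤⟨ ≤-aliquot {6 * m x + 7} chain ⟩
    aliquot (6 * m x + 7)       ≡⟨ cong aliquot (6m+c≡ 7 x) ⟩
    aliquot (6 * r + 7 + β * x) ∎
    where
    open ≤-Reasoning
    U = u x
    reassociate : ∀ K x → 440 * K * x ≡ 11 * (40 * K * x)
    reassociate = solve-∀
    scale : ∀ y U → 5 * (6 * y + 7 + 11 * U) ≡ 6 * (5 * y + 4) + 11 + 55 * U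
    scale = solve-∀
    collect : ∀ U → 6 * (16 * U) + 4 * U + 55 * U ≡ 5 * (U * 31)
    collect = solve-∀
    3≤U : 3 ≤ U
    3≤U = ≤-trans 3≤u₀ (m≤m+n u₀ (40 * K * x))
    11≤4U : 11 ≤ 4 * U
    11≤4U = <⇒≤ (*-monoʳ-≤ 4 3≤U)
    powers-of-2 : List ℕ
    powers-of-2 = 1 ∷ 2 ∷ 4 ∷ 8 ∷ 16 ∷ []
    chain : 6 * m x + 7 + 11 * U ≤ σ (6 * m x + 7)
    chain = begin
      6 * m x + 7 + 11 * U  ≤⟨ *-cancelˡ-≤ 5 (begin
        5 * (6 * m x + 7 + 11 * U)     ≡⟨ scale (m x) U ⟩
        6 * (5 * m x + 4) + 11 + 55 * U ≡⟨ cong (λ n → 6 * n + 11 + 55 * U) (5m+4≡16u x) ⟩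
        6 * (16 * U) + 11 + 55 * U     ≤⟨ +-monoˡ-≤ (55 * U) (+-monoʳ-≤ (6 * (16 * U)) 11≤4U) ⟩
        6 * (16 * U) + 4 * U + 55 * U  ≡⟨ collect U ⟩
        5 * (U * 31)                   ∎) ⟩
      U * sum powers-of-2    ≤⟨ *-sum≤σ z<s (≤-trans z<s 3≤U) (from-yes (unique? powers-of-2))
                                                              (from-yes (all? (_∣? 16) powers-of-2)) ⟩
      σ (16 * U)             ≡⟨ cong σ (5m+4≡16u x) ⟨
      σ (5 * m x + 4)        ≤⟨ fails ⟩
      σ (6 * m x + 7)        ∎

  module _ (coprime₁ : Coprime (6 * r + 17) β) (coprime₂ : Coprime (6 * r + 7) β)
           (small∣β : ∀ {d} → 1 < d → d < 256 → d ∣ β) (s₀ : ℕ) (s₀≤512 : s₀ ≤ 512)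
           (X₁<2^s₀+8 : 6 * r + 17 + 512 * β < 2 ^ (s₀ + 8))
           (X₂<2^s₀+8 : 6 * r + 7 + 512 * β < 2 ^ (s₀ + 8))
           (X₁<8192c₁ : 6 * r + 17 + 512 * β < 8192 * (256 * E))
           (X₂<8192c₂ : 6 * r + 7 + 512 * β < 8192 * (440 * K))
           where

    arbitrarily-large : ∀ N →
      ∃[ m ] (N < m × 0 < m × σ (2 * m + 5) > σ (6 * m + 17) × σ (5 * m + 4) > σ (6 * m + 7))
    arbitrarily-large N = from-witness (count-pigeonhole first-fails? second-fails? L L few-failures)
      where
      h = N + 9
      H = 2 ^ h
      L = 256 * H
      s₀≤H : s₀ ≤ H
      s₀≤H = ≤-trans s₀≤512 (^-monoʳ-≤ 2 (m≤n+m 9 N))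
      0<6r+suc : ∀ c → 0 < 6 * r + suc c
      0<6r+suc c = <-≤-trans z<s (m≤n+m (suc c) (6 * r))
      few-failures : count first-fails? L L + count second-fails? L L < L
      few-failures = begin-strict
        count first-fails? L L + count second-fails? L L
          <⟨ +-mono-< (few-exceptions {c = 256 * E} (0<6r+suc 16) coprime₁ small∣β first-fails?
                                      first-fails⇒large-aliquot X₁<2^s₀+8 X₁<8192c₁ h s₀≤H)
                      (few-exceptions {c = 440 * K} (0<6r+suc 6) coprime₂ small∣β second-fails?
                                      second-fails⇒large-aliquot X₂<2^s₀+8 X₂<8192c₂ h s₀≤H) ⟩
        128 * H + 128 * H ≡⟨ double H ⟩
        L                 ∎
        where
        open ≤-Reasoning
        double : ∀ H → 128 * H + 128 * H ≡ 256 * H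
        double = solve-∀
      N<m : ∀ {x} → L ≤ x → N < m x
      N<m {x} L≤x = begin-strict
        N           <⟨ <-trans (m<m+n N z<s) (n<2^n (N + 9)) ⟩
        H           ≤⟨ m≤n*m H 256 ⟩
        L           ≤⟨ L≤x ⟩
        x           ≤⟨ m≤n*m x (128 * K) {{>-nonZero (*-monoʳ-< 128 0<K)}} ⟩
        128 * K * x ≤⟨ m≤n+m (128 * K * x) r ⟩
        m x         ∎
        where open ≤-Reasoning
      from-witness : ∃[ x ] (L ≤ x × x < L + L × ¬ FirstFails x × ¬ SecondFails x) →
                     ∃[ m ] (N < m × 0 < m × σ (2 * m + 5) > σ (6 * m + 17) × σ (5 * m + 4) > σ (6 * m + 7))
      from-witness (x , L≤x , _ , first-holds , second-holds) =
        m x , N<m L≤x , <-≤-trans z<s (N<m L≤x) , ≰⇒> first-holds , ≰⇒> second-holds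

odd-numbers : List ℕ
odd-numbers = applyUpTo (λ i → suc (2 * i)) 128

K : ℕ
K = foldr lcm 1 odd-numbers

codivisors : List ℕ
codivisors = map (K div_) odd-numbers

-- The 15 in r is what makes 16 divide 5 m + 4.
r u₀ E : ℕ
r  = (15 * K ∸ 5) / 2
u₀ = (5 * r + 4) / 16
E  = sum codivisors ∸ (3 * K + 2)

codivisors-unique : Unique codivisors
codivisors-unique = from-yes (unique? codivisors)

codivisors∣K : All (_∣ K) codivisors
codivisors∣K = from-yes (all? (_∣? K) codivisors)

coprime₁ : Coprime (6 * r + 17) (768 * K)
coprime₁ = from-yes (coprime? (6 * r + 17) (768 * K))

coprime₂ : Coprime (6 * r + 7) (768 * K)
coprime₂ = from-yes (coprime? (6 * r + 7) (768 * K))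

small∣768K : ∀ {d} → 1 < d → d < 256 → d ∣ 768 * K
small∣768K 1<d d<256 = from-yes (allUpTo? (λ d → 1 <? d →-dec d ∣? 768 * K) 256) d<256 1<d

X₁<2^374 : 6 * r + 17 + 512 * (768 * K) < 2 ^ (366 + 8)
X₁<2^374 = from-yes (6 * r + 17 + 512 * (768 * K) <? 2 ^ (366 + 8))

X₂<2^374 : 6 * r + 7 + 512 * (768 * K) < 2 ^ (366 + 8)
X₂<2^374 = from-yes (6 * r + 7 + 512 * (768 * K) <? 2 ^ (366 + 8))

X₁<8192c₁ : 6 * r + 17 + 512 * (768 * K) < 8192 * (256 * E)
X₁<8192c₁ = from-yes (6 * r + 17 + 512 * (768 * K) <? 8192 * (256 * E))

X₂<8192c₂ : 6 * r + 7 + 512 * (768 * K) < 8192 * (440 * K)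
X₂<8192c₂ = from-yes (6 * r + 7 + 512 * (768 * K) <? 8192 * (440 * K))

theorem3 : ∀ (N : ℕ) → ∃[ m ] (N < m × 0 < m × σ (2 * m + 5) > σ (6 * m + 17) × σ (5 * m + 4) > σ (6 * m + 7))
theorem3 = Construction.arbitrarily-large K r u₀ E codivisors codivisors-unique codivisors∣K refl refl refl
  (from-yes (3 ≤? u₀)) coprime₁ coprime₂ small∣768K 366 (from-yes (366 ≤? 512))
  X₁<2^374 X₂<2^374 X₁<8192c₁ X₂<8192c₂
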